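{- A CK-frame $(X,e,\le,R)$ validates $N_\Diamond$ ($\Diamond\bot\to\bot$) if and only if it satisfies: for all $x$, if $yRe$ for all $y\ge x$, then $x=e$.
   Context: Formulas are built from propositional variables, $\bot,\wedge,\vee,\to,\Box,\Diamond$. A CK-frame is $(X,e,\le,R)$ with $(X,\le)$ a preorder, $e\in X$ such that $e\le y$ implies $y=e$, and $R\subseteq X\times X$ such that $eRx$ iff $x=e$. A valuation maps each variable to an upset of $(X,\le)$ containing $e$. Forcing: $x\Vdash p$ iff $x\in V(p)$; $x\Vdash\bot$ iff $x=e$; $\wedge,\vee$ pointwise; $x\Vdash\varphi\to\psi$ iff for all $y\ge x$, $y\Vdash\varphi$ implies $y\Vdash\psi$; $x\Vdash\Box\varphi$ iff for all $y,z$ with $x\le y$ and $yRz$, $z\Vdash\varphi$; $x\Vdash\Diamond\varphi$ iff for all $y\ge x$ there is $z$ with $yRz$ and $z\Vdash\varphi$. A frame validates a formula if it is forced at every world under every valuation. -}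

module Defs where

open import Data.Nat using (ℕ)
open import Data.Product using (Σ; _×_; _,_)
open import Data.Sum using (_⊎_)
open import Data.Empty using (⊥)
open import Relation.Binary.PropositionalEquality using (_≡_)

data Form : Set where
  var  : ℕ → Form
  ⊥'   : Form
  _∧'_ : Form → Form → Form
  _∨'_ : Form → Form → Form
  _⇒_  : Form → Form → Form
  □    : Form → Form
  ◇    : Form → Form

record CKFrame : Set₁ where
  field
    X       : Set
    e       : X
    _≤_     : X → X → Set
    R       : X → X → Set
    ≤-refl  : ∀ {x} → x ≤ x
    ≤-trans : ∀ {x y z} → x ≤ y → y ≤ z → x ≤ z
    e-max   : ∀ {y} → e ≤ y → y ≡ e
    eR⇔     : ∀ {x} → (R e x → x ≡ e) × (x ≡ e → R e x)

record Valuation (F : CKFrame) : Set₁ where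
  open CKFrame F
  field
    V      : ℕ → X → Set
    upward : ∀ p {x y} → x ≤ y → V p x → V p y
    V-e    : ∀ p → V p e

module _ (F : CKFrame) (M : Valuation F) where
  open CKFrame F
  open Valuation M

  _⊩_ : X → Form → Set
  x ⊩ var p   = V p x
  x ⊩ ⊥'      = x ≡ e
  x ⊩ (φ ∧' ψ) = (x ⊩ φ) × (x ⊩ ψ)
  x ⊩ (φ ∨' ψ) = (x ⊩ φ) ⊎ (x ⊩ ψ)
  x ⊩ (φ ⇒ ψ)  = ∀ y → x ≤ y → y ⊩ φ → y ⊩ ψ
  x ⊩ □ φ     = ∀ y z → x ≤ y → R y z → z ⊩ φ
  x ⊩ ◇ φ     = ∀ y → x ≤ y → Σ X λ z → R y z × (z ⊩ φ)

Validates : CKFrame → Form → Set₁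
Validates F φ = (M : Valuation F) → (x : CKFrame.X F) → _⊩_ F M x φ

N◇ : Form
N◇ = ◇ ⊥' ⇒ ⊥'

NCond : CKFrame → Set
NCond F = (x : X) → (∀ y → x ≤ y → R y e) → x ≡ e
  where open CKFrame F

{-# OPTIONS --safe #-}
module Submission where

-- Because ⊥ holds only at e, x forces ◇⊥ exactly when every y ≥ x has e as an
-- R-successor, whatever the valuation. So N◇ forced at x says that every y ≥ x with
-- this property equals e, which is the frame condition read at the worlds above x.

open import Defs
open import Data.Product using (_×_; _,_)
open import Data.Unit using (⊤; tt)
open import Relation.Binary.PropositionalEquality using (refl; subst)

⊤-valuation : (F : CKFrame) → Valuation F
⊤-valuation F = record { V = λ _ _ → ⊤ ; upward = λ _ _ _ → tt ; V-e = λ _ → tt }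

module _ (F : CKFrame) where
  open CKFrame F

  AlwaysSeesE : X → Set
  AlwaysSeesE x = ∀ y → x ≤ y → R y e

  module _ (M : Valuation F) where

    ⊩◇⊥⇒alwaysSeesE : ∀ {x} → _⊩_ F M x (◇ ⊥') → AlwaysSeesE x
    ⊩◇⊥⇒alwaysSeesE x⊩◇⊥ y x≤y = let (z , yRz , z≡e) = x⊩◇⊥ y x≤y in subst (R y) z≡e yRz

    alwaysSeesE⇒⊩◇⊥ : ∀ {x} → AlwaysSeesE x → _⊩_ F M x (◇ ⊥')
    alwaysSeesE⇒⊩◇⊥ seesE y x≤y = e , seesE y x≤y , refl

  validates-N◇⇒NCond : Validates F N◇ → NCond F
  validates-N◇⇒NCond valid x seesE =
    valid (⊤-valuation F) x x ≤-refl (alwaysSeesE⇒⊩◇⊥ (⊤-valuation F) seesE)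

  NCond⇒validates-N◇ : NCond F → Validates F N◇
  NCond⇒validates-N◇ cond M x y x≤y y⊩◇⊥ = cond y (⊩◇⊥⇒alwaysSeesE M y⊩◇⊥)

mainTheorem10 : (F : CKFrame) → (Validates F N◇ → NCond F) × (NCond F → Validates F N◇)
mainTheorem10 F = validates-N◇⇒NCond F , NCond⇒validates-N◇ F
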